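{- Let $m\in\mathbb N$. There exists a number $K(m)$ such that for every $r<m$, no deterministic online algorithm for Online Makespan Hypergraph Coloring with $m$ colors is $r$-competitive, even when the instances are restricted to hyperforests with $K(m)$ hyperedges.
   Context: Online Makespan Hypergraph Coloring with $m$ colors: a hypergraph $\mathcal H=(V,E)$ with nodes $V=[n]$ is revealed online; nodes are revealed in the order $1,2,\dots,n$, and when node $j$ is revealed the algorithm learns the partial hyperedges $e\cap[j]$ for all $e\in E$, and must then irrevocably assign $j$ a color $c(j)\in[m]$. The objective (makespan) is $\max_{i\in[m]}\max_{e\in E}|c^{ -1}(i)\cap e|$, to be minimized. (This is the unit-processing-time case of online makespan scheduling under scenarios, with nodes as jobs, hyperedges as scenarios and colors as machines.) A deterministic online algorithm is $r$-competitive if on every instance its objective value is at most $r$ times the minimum objective over all colorings $[n]\to[m]$. A hypercycle is a sequence $v_1,e_1,v_2,\dots,e_\ell,v_{\ell+1}=v_1$ with pairwise distinct hyperedges $e_t$ such that $v_t,v_{t+1}\in e_t$ for all $t\in[\ell]$; a hyperforest is a hypergraph without a hypercycle. -}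

module Defs where

open import Data.Nat using (ℕ; zero; suc; _⊔_; _≤_)
open import Data.Bool using (Bool; true; false; if_then_else_; _∧_)
open import Data.Fin using (Fin; zero; suc; toℕ; inject₁; fromℕ; _≟_)
open import Data.Fin.Subset using (Subset)
open import Data.List using (List; length; lookup; take; allFin; map)
open import Data.Nat.ListAction using (sum)
open import Data.Vec using () renaming (lookup to vlookup)
open import Data.Product using (Σ; ∃; ∃-syntax; _×_)
open import Relation.Nullary using (¬_; does)
open import Relation.Binary.PropositionalEquality using (_≡_)
open import Function.Definitions using (Injective)
open import Data.Integer using (+_)
import Data.Rational as ℚ
open ℚ using (ℚ)

-- A hypergraph with K (labelled) hyperedges, presented in the online order:
-- the list entry at position j is the set of hyperedges (a subset of Fin K)
-- containing node j.  So the nodes are Fin (length H), revealed in the order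
-- 0,1,...,n-1, and hyperedge k is { j | k ∈ H[j] }.
Hypergraph : ℕ → Set
Hypergraph K = List (Subset K)

nodes : ∀ {K} → Hypergraph K → ℕ
nodes H = length H

inEdge : ∀ {K} (H : Hypergraph K) → Fin (nodes H) → Fin K → Bool
inEdge H j k = vlookup (lookup H j) k

DistinctEdges : ∀ {K} → Hypergraph K → Set
DistinctEdges {K} H =
  ∀ (k k′ : Fin K) → (∀ j → inEdge H j k ≡ inEdge H j k′) → k ≡ k′

HyperCycle : ∀ {K} → Hypergraph K → Set
HyperCycle {K} H =
  Σ ℕ λ ℓ → (2 ≤ ℓ) ×
  Σ (Fin (suc ℓ) → Fin (nodes H)) λ v →
  Σ (Fin ℓ → Fin K) λ e →
    (v (fromℕ ℓ) ≡ v zero)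
  × Injective _≡_ _≡_ (λ t → v (inject₁ t))
  × Injective _≡_ _≡_ e
  × (∀ t → inEdge H (v (inject₁ t)) (e t) ≡ true)
  × (∀ t → inEdge H (v (suc t)) (e t) ≡ true)

Hyperforest : ∀ {K} → Hypergraph K → Set
Hyperforest H = ¬ HyperCycle H

Coloring : ∀ {K} → Hypergraph K → ℕ → Set
Coloring H m = Fin (nodes H) → Fin m

maxFin : (n : ℕ) → (Fin n → ℕ) → ℕ
maxFin zero    f = 0
maxFin (suc n) f = f zero ⊔ maxFin n (λ i → f (suc i))

load : ∀ {K m} (H : Hypergraph K) → Coloring H m → Fin m → Fin K → ℕ
load H c i k =
  sum (map (λ j → if does (c j ≟ i) ∧ inEdge H j k then 1 else 0) (allFin (nodes H)))

makespan : ∀ {K m} (H : Hypergraph K) → Coloring H m → ℕ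
makespan {K} {m} H c = maxFin m (λ i → maxFin K (λ k → load H c i k))

IsOpt : ∀ {K} (m : ℕ) (H : Hypergraph K) → ℕ → Set
IsOpt m H o = (∃[ c ] makespan {m = m} H c ≡ o) × (∀ (c : Coloring H m) → o ≤ makespan H c)

-- A deterministic online algorithm: when node j is revealed it knows the
-- membership sets of the earlier nodes 0..j-1 (in order) and of node j, i.e.
-- exactly the partial hyperedges e ∩ [j]; it outputs the colour of node j.
OnlineAlg : ℕ → ℕ → Set
OnlineAlg m K = List (Subset K) → Subset K → Fin m

runAlg : ∀ {m K} → OnlineAlg m K → (H : Hypergraph K) → Coloring H m
runAlg A H j = A (take (toℕ j) H) (lookup H j)

toℚ : ℕ → ℚ
toℚ n = + n ℚ./ 1

CompetitiveOnHyperforests : ∀ {m K} → OnlineAlg m K → ℚ → Set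
CompetitiveOnHyperforests {m} {K} A r =
  ∀ (H : Hypergraph K) → Hyperforest H → DistinctEdges H →
  ∀ (o : ℕ) → IsOpt m H o →
  toℚ (makespan H (runAlg A H)) ℚ.≤ r ℚ.* toℚ o

{-# OPTIONS --safe #-}
-- Call a hyperedge whose p nodes the algorithm has all coloured x a chip of colour x and size p.  If for
-- every colour z with demand s z > 0 the adversary holds a chip of colour z and size s z, a new node
-- joining all of them and a fresh hyperedge receives some colour x, and the chip of colour x grows to size
-- s x + 1.  The chips for demand s are obtained colour by colour from the same game for the demand lowered
-- by one at that colour; if that game ends in a chip of another colour, it is already large enough.
-- Induction on the total demand, starting from demand m − 1 at every colour, forces m nodes of one colour
-- into one hyperedge.  Throughout, node j opens the fresh hyperedge j and every node has at most one
-- hyperedge that reappears after it.  This excludes hypercycles (look at their earliest node), and since no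
-- hyperedge exceeds m nodes, colouring greedily from the last node backwards makes every hyperedge rainbow:
-- the optimum is 1.  Isolated nodes pad the instance to exactly K hyperedges.
module Submission where

open import Defs
open import Data.Nat using (ℕ; zero; suc; _≤_)
open import Data.Product using (∃-syntax; _,_)
open import Relation.Nullary using (¬_)

module Hypergraphs where

  open import Data.Nat using (_+_; _<_; z≤n; s≤s)
  open import Data.Nat.Properties
    using (≤-refl; ≤-reflexive; ≤-trans; ≤-antisym; ≤-pred; <-irrefl; ≤∧≢⇒<; m≤n⇒m<n∨m≡n;
           m≤n+m; m≤m⊔n; m≤n⊔m; ⊔-lub; +-assoc; +-comm; +-identityʳ)
  open import Data.Bool using (Bool; true; false; if_then_else_; _∧_)
  import Data.Bool.Properties as Bool
  open import Data.Fin using (Fin; zero; suc; toℕ; inject₁; fromℕ; fromℕ<; _≟_)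
  open import Data.Fin.Properties using (toℕ-injective; toℕ-fromℕ<; toℕ-inject₁; any?; pigeonhole)
  open import Data.Fin.Subset using (Subset) renaming (⊥ to ∅)
  open import Data.List using (List; []; _∷_; [_]; length; lookup; take; allFin; map; _++_; _∷ʳ_)
  open import Data.List.Properties using (map-tabulate)
  open import Data.List.Extrema.Nat using (argmin; f[argmin]≤f[xs])
  import Data.List.Relation.Unary.All as All
  open import Data.List.Relation.Unary.Any using (index; here; there)
  open import Data.List.Relation.Unary.Any.Properties using (lookup-index)
  open import Data.List.Membership.Propositional using (_∈_; _∉_)
  open import Data.List.Membership.Propositional.Properties using (∈-allFin)
  import Data.List.Membership.DecPropositional as DecMembership
  open import Data.Nat.ListAction using (sum)
  open import Data.Vec using () renaming (lookup to vlookup)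
  open import Data.Vec.Properties using (lookup-replicate)
  open import Data.Product using (∃; ∃₂; _×_; proj₁; proj₂)
  import Data.Product as Product
  open import Data.Sum using (_⊎_; inj₁; inj₂)
  import Data.Sum as Sum
  open import Function using (_∘_; id)
  open import Relation.Nullary using (Dec; yes; no; does; ¬?; _×-dec_; contradiction)
  open import Relation.Nullary.Decidable using (decidable-stable)
  open import Relation.Binary.PropositionalEquality
    using (_≡_; _≢_; refl; sym; trans; cong; subst; module ≡-Reasoning)

  private variable K : ℕ

  -- ∅ past the end of the list, so that mem G j k is false there.
  nodeAt : List (Subset K) → ℕ → Subset K
  nodeAt []      j       = ∅
  nodeAt (h ∷ G) zero    = h
  nodeAt (h ∷ G) (suc j) = nodeAt G j

  mem : List (Subset K) → ℕ → Fin K → Bool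
  mem G j k = vlookup (nodeAt G j) k

  lookup≡nodeAt : (G : List (Subset K)) (j : Fin (length G)) → lookup G j ≡ nodeAt G (toℕ j)
  lookup≡nodeAt (h ∷ G) zero    = refl
  lookup≡nodeAt (h ∷ G) (suc j) = lookup≡nodeAt G j

  inEdge≡mem : (H : Hypergraph K) (j : Fin (nodes H)) (k : Fin K) → inEdge H j k ≡ mem H (toℕ j) k
  inEdge≡mem H j k = cong (λ h → vlookup h k) (lookup≡nodeAt H j)

  inEdge⇒mem : (H : Hypergraph K) {j : Fin (nodes H)} {k : Fin K} → inEdge H j k ≡ true → mem H (toℕ j) k ≡ true
  inEdge⇒mem H {j} {k} j∈k = trans (sym (inEdge≡mem H j k)) j∈k

  mem⇒<length : ∀ (G : List (Subset K)) j {k} → mem G j k ≡ true → j < length G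
  mem⇒<length []      j       {k} e with () ← trans (sym (lookup-replicate k false)) e
  mem⇒<length (h ∷ G) zero    e = s≤s z≤n
  mem⇒<length (h ∷ G) (suc j) e = s≤s (mem⇒<length G j e)

  length-∷ʳ : ∀ {a} {A : Set a} (xs : List A) x → length (xs ∷ʳ x) ≡ suc (length xs)
  length-∷ʳ []       x = refl
  length-∷ʳ (_ ∷ xs) x = cong suc (length-∷ʳ xs x)

  take-++ˡ : ∀ {a} {A : Set a} (xs ys : List A) {j} → j ≤ length xs → take j (xs ++ ys) ≡ take j xs
  take-++ˡ xs       ys {zero}  _         = refl
  take-++ˡ (x ∷ xs) ys {suc j} (s≤s j≤n) = cong (x ∷_) (take-++ˡ xs ys j≤n)

  nodeAt-++ˡ : (G ns : List (Subset K)) {j : ℕ} → j < length G → nodeAt (G ++ ns) j ≡ nodeAt G j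
  nodeAt-++ˡ (h ∷ G) ns {zero}  _         = refl
  nodeAt-++ˡ (h ∷ G) ns {suc j} (s≤s j<n) = nodeAt-++ˡ G ns j<n

  nodeAt-++ʳ : (G ns : List (Subset K)) (i : ℕ) → nodeAt (G ++ ns) (length G + i) ≡ nodeAt ns i
  nodeAt-++ʳ []      ns i = refl
  nodeAt-++ʳ (h ∷ G) ns i = nodeAt-++ʳ G ns i

  nodeAt-∷ʳ : (G : List (Subset K)) (w : Subset K) → nodeAt (G ∷ʳ w) (length G) ≡ w
  nodeAt-∷ʳ []      w = refl
  nodeAt-∷ʳ (h ∷ G) w = nodeAt-∷ʳ G w

  mem-++ˡ : (G ns : List (Subset K)) {j : ℕ} {k : Fin K} → j < length G → mem (G ++ ns) j k ≡ mem G j k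
  mem-++ˡ G ns {k = k} j<n = cong (λ h → vlookup h k) (nodeAt-++ˡ G ns j<n)

  mem-∷ʳ⁻ : (G : List (Subset K)) (w : Subset K) {j : ℕ} {k : Fin K} → mem (G ∷ʳ w) j k ≡ true →
    (j < length G × mem G j k ≡ true) ⊎ (j ≡ length G × vlookup w k ≡ true)
  mem-∷ʳ⁻ G w {j} {k} j∋k
    with m≤n⇒m<n∨m≡n (≤-pred (subst (j <_) (length-∷ʳ G w) (mem⇒<length (G ∷ʳ w) j j∋k)))
  ... | inj₁ j<n  = inj₁ (j<n , trans (sym (mem-++ˡ G [ w ] j<n)) j∋k)
  ... | inj₂ refl = inj₂ (refl , trans (cong (λ h → vlookup h k) (sym (nodeAt-∷ʳ G w))) j∋k)

  size : List (Subset K) → Fin K → ℕ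
  size []      k = 0
  size (h ∷ G) k = (if vlookup h k then 1 else 0) + size G k

  size-++ : (G ns : List (Subset K)) (k : Fin K) → size (G ++ ns) k ≡ size G k + size ns k
  size-++ []      ns k = refl
  size-++ (h ∷ G) ns k = trans (cong (_ +_) (size-++ G ns k)) (sym (+-assoc (if vlookup h k then 1 else 0) (size G k) _))

  size≡0 : (G : List (Subset K)) (k : Fin K) → (∀ {j} → mem G j k ≢ true) → size G k ≡ 0
  size≡0 []      k _    = refl
  size≡0 (h ∷ G) k none with vlookup h k in h∋k
  ... | true  = contradiction h∋k (none {0})
  ... | false = size≡0 G k λ {j} → none {suc j}

  mem-∷ʳ-new : (G : List (Subset K)) (w : Subset K) {k : Fin K} → mem (G ∷ʳ w) (length G) k ≡ vlookup w k
  mem-∷ʳ-new G w {k} = cong (λ h → vlookup h k) (nodeAt-∷ʳ G w)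

  size-∷ʳ : (G : List (Subset K)) (w : Subset K) (k : Fin K) →
    size (G ∷ʳ w) k ≡ (if vlookup w k then 1 else 0) + size G k
  size-∷ʳ G w k = trans (size-++ G [ w ] k) (trans (cong (size G k +_) (+-identityʳ _)) (+-comm (size G k) _))

  load-∷ : ∀ {m} h (T : Hypergraph K) (c : Coloring (h ∷ T) m) i k →
    load (h ∷ T) c i k ≡ (if does (c zero ≟ i) ∧ vlookup h k then 1 else 0) + load T (c ∘ suc) i k
  load-∷ h T c i k =
    cong (entry zero +_) (cong sum (trans (map-tabulate suc entry) (sym (map-tabulate id (entry ∘ suc)))))
    where entry = λ j → if does (c j ≟ i) ∧ inEdge (h ∷ T) j k then 1 else 0

  load≡size : ∀ {m} (H : Hypergraph K) (c : Coloring H m) i k →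
    (∀ j → inEdge H j k ≡ true → c j ≡ i) → load H c i k ≡ size H k
  load≡size []      c i k _ = refl
  load≡size (h ∷ T) c i k all-i rewrite load-∷ h T c i k
    | load≡size T (c ∘ suc) i k (all-i ∘ suc) with c zero ≟ i | vlookup h k in h∋k
  ... | yes _   | _     = refl
  ... | no  _   | false = refl
  ... | no  c≢i | true  = contradiction (all-i zero h∋k) c≢i

  load≡0 : ∀ {m} (H : Hypergraph K) (c : Coloring H m) i k →
    (∀ j → inEdge H j k ≡ true → c j ≢ i) → load H c i k ≡ 0
  load≡0 []      c i k _ = refl
  load≡0 (h ∷ T) c i k none-i rewrite load-∷ h T c i k
    | load≡0 T (c ∘ suc) i k (none-i ∘ suc) with c zero ≟ i | vlookup h k in h∋k
  ... | no  _   | _     = refl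
  ... | yes _   | false = refl
  ... | yes c≡i | true  = contradiction c≡i (none-i zero h∋k)

  1≤load : ∀ {m} (H : Hypergraph K) (c : Coloring H m) {j k} → inEdge H j k ≡ true → 1 ≤ load H c (c j) k
  1≤load (h ∷ T) c {zero} {k} h∋k rewrite load-∷ h T c (c zero) k | h∋k with c zero ≟ c zero
  ... | yes _ = s≤s z≤n
  ... | no  c≢c = contradiction refl c≢c
  1≤load (h ∷ T) c {suc j} {k} j∋k rewrite load-∷ h T c (c (suc j)) k =
    ≤-trans (1≤load T (c ∘ suc) j∋k) (m≤n+m _ _)

  maxFin-≥ : ∀ n (f : Fin n → ℕ) i → f i ≤ maxFin n f
  maxFin-≥ (suc n) f zero    = m≤m⊔n _ _
  maxFin-≥ (suc n) f (suc i) = ≤-trans (maxFin-≥ n (f ∘ suc) i) (m≤n⊔m _ _)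

  maxFin-≤ : ∀ n (f : Fin n → ℕ) {b} → (∀ i → f i ≤ b) → maxFin n f ≤ b
  maxFin-≤ zero    f f≤b = z≤n
  maxFin-≤ (suc n) f f≤b = ⊔-lub (f≤b zero) (maxFin-≤ n (f ∘ suc) (f≤b ∘ suc))

  load≤makespan : ∀ {m} (H : Hypergraph K) (c : Coloring H m) i k → load H c i k ≤ makespan H c
  load≤makespan {K} {m} H c i k =
    ≤-trans (maxFin-≥ K (load H c i) k) (maxFin-≥ m (λ i → maxFin K (load H c i)) i)

  makespan≤ : ∀ {m} (H : Hypergraph K) (c : Coloring H m) {b} →
    (∀ i k → load H c i k ≤ b) → makespan H c ≤ b
  makespan≤ {K} {m} H c load≤b = maxFin-≤ m _ (λ i → maxFin-≤ K _ (load≤b i))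

  SingleForwardEdge : Hypergraph K → Set
  SingleForwardEdge H = ∀ {j j₁ j₂ k₁ k₂} → j < j₁ → j < j₂ →
    mem H j k₁ ≡ true → mem H j₁ k₁ ≡ true →
    mem H j k₂ ≡ true → mem H j₂ k₂ ≡ true → k₁ ≡ k₂

  fromℕ-or-inject₁ : ∀ {n} (t : Fin (suc n)) → t ≡ fromℕ n ⊎ ∃ λ t′ → t ≡ inject₁ t′
  fromℕ-or-inject₁ {zero}  zero    = inj₁ refl
  fromℕ-or-inject₁ {suc n} zero    = inj₂ (zero , refl)
  fromℕ-or-inject₁ {suc n} (suc t) = Sum.map (cong suc) (Product.map suc (cong suc)) (fromℕ-or-inject₁ t)

  suc≢inject₁ : ∀ {n} (t : Fin n) → suc t ≢ inject₁ t
  suc≢inject₁ t eq = <-irrefl (trans (sym (toℕ-inject₁ t)) (sym (cong toℕ eq))) ≤-refl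

  module ClosedWalk {a} {A : Set a} {n} (v : Fin (suc (suc (suc n))) → A)
                    (closed : v (fromℕ (suc (suc n))) ≡ v zero) where

    prev : Fin (suc (suc n)) → Fin (suc (suc n))
    prev zero    = fromℕ (suc n)
    prev (suc t) = inject₁ t

    prev-≢ : ∀ t → prev t ≢ t
    prev-≢ zero    ()
    prev-≢ (suc t) eq = suc≢inject₁ t (sym eq)

    v-suc-prev : ∀ t → v (suc (prev t)) ≡ v (inject₁ t)
    v-suc-prev zero    = closed
    v-suc-prev (suc t) = refl

    v-suc : ∀ t → ∃ λ t′ → t′ ≢ t × v (suc t) ≡ v (inject₁ t′)
    v-suc t with fromℕ-or-inject₁ t
    ... | inj₁ refl       = zero , (λ ()) , closed
    ... | inj₂ (t′ , refl) = suc t′ , suc≢inject₁ t′ , refl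

  -- At the earliest node of a hypercycle, the two cycle edges through it both contain a later node.
  singleForwardEdge⇒hyperforest : (H : Hypergraph K) → SingleForwardEdge H → Hyperforest H
  singleForwardEdge⇒hyperforest _ _ (zero , () , _)
  singleForwardEdge⇒hyperforest _ _ (suc zero , s≤s () , _)
  singleForwardEdge⇒hyperforest H single
    (suc (suc n) , _ , v , e , closed , v-inj , e-inj , ∈e-start , ∈e-end) = prev-≢ t (e-inj e≡)
    where
    open ClosedWalk v closed
    node : Fin (suc (suc n)) → ℕ
    node t = toℕ (v (inject₁ t))
    t = argmin node zero (allFin _)
    later : ∀ {t′} → t′ ≢ t → node t < node t′
    later t′≢t = ≤∧≢⇒< (All.lookup (f[argmin]≤f[xs] {f = node} zero (allFin _)) (∈-allFin _))
                       (λ eq → t′≢t (sym (v-inj (toℕ-injective eq))))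
    next = v-suc t
    e≡ : e (prev t) ≡ e t
    e≡ = single (later (prev-≢ t)) (later (proj₁ (proj₂ next)))
      (inEdge⇒mem H (subst (λ x → inEdge H x (e (prev t)) ≡ true) (v-suc-prev t) (∈e-end (prev t))))
      (inEdge⇒mem H (∈e-start (prev t)))
      (inEdge⇒mem H (∈e-start t))
      (inEdge⇒mem H (subst (λ x → inEdge H x (e t) ≡ true) (proj₂ (proj₂ next)) (∈e-end t)))

  mem⇒inEdge : (H : Hypergraph K) {i : ℕ} {k : Fin K} (i∈k : mem H i k ≡ true) →
    inEdge H (fromℕ< (mem⇒<length H i i∈k)) k ≡ true
  mem⇒inEdge H {i} {k} i∈k =
    trans (inEdge≡mem H _ k) (trans (cong (λ x → mem H x k) (toℕ-fromℕ< (mem⇒<length H i i∈k))) i∈k)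

  sameNodes⇒mem : (H : Hypergraph K) {k k′ : Fin K} → (∀ j → inEdge H j k ≡ inEdge H j k′) →
    ∀ {i} → mem H i k ≡ true → mem H i k′ ≡ true
  sameNodes⇒mem H {k} {k′} same {i} i∈k = begin
    mem H i k′               ≡⟨ cong (λ x → mem H x k′) (toℕ-fromℕ< i<n) ⟨
    mem H (toℕ j) k′         ≡⟨ inEdge≡mem H j k′ ⟨
    inEdge H j k′            ≡⟨ same j ⟨
    inEdge H j k             ≡⟨ mem⇒inEdge H i∈k ⟩
    true                     ∎
    where
    open ≡-Reasoning
    i<n = mem⇒<length H i i∈k
    j = fromℕ< i<n

  firstNode⇒distinctEdges : (H : Hypergraph K) →
    (∀ {j k} → mem H j k ≡ true → toℕ k ≤ j) → (∀ k → mem H (toℕ k) k ≡ true) → DistinctEdges H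
  firstNode⇒distinctEdges H starts-after starts-at k k′ same = toℕ-injective (≤-antisym
    (starts-after (sameNodes⇒mem H (λ j → sym (same j)) (starts-at k′)))
    (starts-after (sameNodes⇒mem H same (starts-at k))))

  module _ {n : ℕ} where
    open DecMembership (_≟_ {n}) using (_∈?_)

    ∃∉ : (L : List (Fin n)) → length L < n → ∃ (_∉ L)
    ∃∉ L |L|<n with any? (λ c → ¬? (c ∈? L))
    ... | yes c∉L = c∉L
    ... | no ¬∃∉  = contradiction (pigeonhole |L|<n (index ∘ covered)) injective
      where
      covered : ∀ c → c ∈ L
      covered c = decidable-stable (c ∈? L) (¬∃∉ ∘ (c ,_))
      injective : ¬ ∃₂ λ i j → toℕ i < toℕ j × index (covered i) ≡ index (covered j)
      injective (i , j , i<j , eq) = <-irrefl (cong toℕ i≡j) i<j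
        where i≡j = trans (lookup-index (covered i)) (trans (cong (lookup L) eq) (sym (lookup-index (covered j))))

  Meet : Subset K → Subset K → Set
  Meet a b = ∃ λ k → vlookup a k ≡ true × vlookup b k ≡ true

  meet? : (a b : Subset K) → Dec (Meet a b)
  meet? a b = any? λ k → (vlookup a k Bool.≟ true) ×-dec (vlookup b k Bool.≟ true)

  coloursMeeting : ∀ {m} (h : Subset K) (T : List (Subset K)) → (Fin (length T) → Fin m) → List (Fin m)
  coloursMeeting h []      c = []
  coloursMeeting h (t ∷ T) c with meet? h t
  ... | yes _ = c zero ∷ coloursMeeting h T (c ∘ suc)
  ... | no  _ = coloursMeeting h T (c ∘ suc)

  module _ {m : ℕ} (h : Subset K) where

    ∈-coloursMeeting : ∀ T (c : Fin (length T) → Fin m) j → Meet h (lookup T j) → c j ∈ coloursMeeting h T c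
    ∈-coloursMeeting (t ∷ T) c zero    meet with meet? h t
    ... | yes _    = here refl
    ... | no  ¬meet = contradiction meet ¬meet
    ∈-coloursMeeting (t ∷ T) c (suc j) meet with meet? h t
    ... | yes _ = there (∈-coloursMeeting T (c ∘ suc) j meet)
    ... | no  _ = ∈-coloursMeeting T (c ∘ suc) j meet

    coloursMeeting≡[] : ∀ T (c : Fin (length T) → Fin m) → (∀ j → ¬ Meet h (lookup T j)) →
      coloursMeeting h T c ≡ []
    coloursMeeting≡[] []      c none = refl
    coloursMeeting≡[] (t ∷ T) c none with meet? h t
    ... | yes meet = contradiction meet (none zero)
    ... | no  _    = coloursMeeting≡[] T (c ∘ suc) (none ∘ suc)

    length-coloursMeeting : ∀ T (c : Fin (length T) → Fin m) k →
      (∀ j → Meet h (lookup T j) → vlookup (lookup T j) k ≡ true) → length (coloursMeeting h T c) ≤ size T k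
    length-coloursMeeting []      c k via-k = z≤n
    length-coloursMeeting (t ∷ T) c k via-k with meet? h t | vlookup t k in t∋k
    ... | yes meet | true  = s≤s (length-coloursMeeting T (c ∘ suc) k (via-k ∘ suc))
    ... | yes meet | false = contradiction (trans (sym (via-k zero meet)) t∋k) λ ()
    ... | no  _    | _     = ≤-trans (length-coloursMeeting T (c ∘ suc) k (via-k ∘ suc)) (m≤n+m _ _)

    few-coloursMeeting : ∀ {m′} T (c : Fin (length T) → Fin m) → SingleForwardEdge (h ∷ T) →
      (∀ k → size (h ∷ T) k ≤ suc m′) → length (coloursMeeting h T c) < suc m′
    few-coloursMeeting {m′} T c single small with any? (λ j → meet? h (lookup T j))
    ... | no none =
      subst (λ L → length L < suc m′) (sym (coloursMeeting≡[] T c (λ j → none ∘ (j ,_)))) (s≤s z≤n)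
    ... | yes (j₀ , k₀ , h∋k₀ , j₀∋k₀) =
      s≤s (≤-trans (length-coloursMeeting T c k₀ via-k₀) size-T≤m′)
      where
      via-k₀ : ∀ j → Meet h (lookup T j) → vlookup (lookup T j) k₀ ≡ true
      via-k₀ j (k , h∋k , j∋k) = subst (λ k′ → vlookup (lookup T j) k′ ≡ true)
        (single (s≤s z≤n) (s≤s z≤n) h∋k (inEdge⇒mem T j∋k) h∋k₀ (inEdge⇒mem T j₀∋k₀)) j∋k
      size-T≤m′ : size T k₀ ≤ m′
      size-T≤m′ = ≤-pred (subst (λ b → (if b then 1 else 0) + size T k₀ ≤ suc m′) h∋k₀ (small k₀))

  -- Greedy from the last node backwards: by single forward edges, the later nodes meeting a node all lie
  -- in one hyperedge through it, so they use at most m′ colours.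
  rainbowColouring : ∀ {m′} (H : Hypergraph K) → SingleForwardEdge H → (∀ k → size H k ≤ suc m′) →
    ∃ λ (c : Coloring H (suc m′)) → ∀ i k → load H c i k ≤ 1
  rainbowColouring []      _      _     = (λ ()) , λ _ _ → z≤n
  rainbowColouring (h ∷ T) single small
    with rainbowColouring T (λ j<j₁ j<j₂ → single (s≤s j<j₁) (s≤s j<j₂))
                            (λ k → ≤-trans (m≤n+m _ _) (small k))
  ... | cT , rainbowT = c , rainbow
    where
    forbidden = coloursMeeting h T cT
    free = ∃∉ forbidden (few-coloursMeeting h T cT single small)
    c : Coloring (h ∷ T) _
    c zero    = proj₁ free
    c (suc j) = cT j
    rainbow : ∀ i k → load (h ∷ T) c i k ≤ 1
    rainbow i k rewrite load-∷ h T c i k with proj₁ free ≟ i | vlookup h k in h∋k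
    ... | no  _    | _     = rainbowT i k
    ... | yes _    | false = rainbowT i k
    ... | yes refl | true  = ≤-reflexive (cong suc (load≡0 T cT _ k λ j j∋k cj≡free →
          proj₂ free (subst (_∈ forbidden) cj≡free (∈-coloursMeeting h T cT j (k , h∋k , j∋k)))))

  singleForwardEdge⇒isOpt-1 : ∀ {m′} (H : Hypergraph K) → SingleForwardEdge H →
    (∀ k → size H k ≤ suc m′) → ∀ {j k} → mem H j k ≡ true → IsOpt (suc m′) H 1
  singleForwardEdge⇒isOpt-1 H single small {j} {k} j∈k with rainbowColouring H single small
  ... | c , rainbow = (c , ≤-antisym (makespan≤ H c rainbow) (1≤makespan c)) , 1≤makespan
    where
    1≤makespan : ∀ c → 1 ≤ makespan H c
    1≤makespan c = ≤-trans (1≤load H c (mem⇒inEdge H j∈k)) (load≤makespan H c _ k)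

module Adversary where

  open Hypergraphs
  open import Data.Nat using (pred; _+_; _*_; _∸_; _<_; z≤n; s≤s; _<?_)
  import Data.Nat as ℕ
  open import Data.Nat.Properties
    using (≤-refl; ≤-reflexive; ≤-trans; <-≤-trans; ≤-<-trans; <-irrefl; <⇒≤; <⇒≱; ≤⇒≯; ≮⇒≥;
           m≤m+n; m≤n+m; m<m+n; m+[n∸m]≡n; +-identityʳ; +-suc; +-assoc; +-comm; +-monoˡ-≤; +-monoʳ-≤;
           ≤-pred; pred[n]≤n; m≤n⇒m<n∨m≡n)
  open import Data.Bool using (true; false; if_then_else_)
  open import Data.Fin using (Fin; zero; suc; toℕ; fromℕ<; _≟_)
  open import Data.Fin.Properties using (toℕ-injective; toℕ-fromℕ<; toℕ<n; any?)
  open import Data.Fin.Subset using (Subset)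
  open import Data.List using (List; []; _∷_; [_]; length; take; allFin; _++_; _∷ʳ_)
  open import Data.List.Properties using (++-assoc; ++-identityʳ; length-++; take-all; length-tabulate)
  open import Data.List.Membership.Propositional using (_∈_)
  open import Data.List.Membership.Propositional.Properties using (∈-allFin)
  open import Data.List.Relation.Unary.Any using (here; there)
  open import Data.Vec using (tabulate) renaming (lookup to vlookup)
  open import Data.Vec.Properties using (lookup∘tabulate)
  open import Data.Vec.Functional using (updateAt)
  open import Data.Vec.Functional.Properties using (updateAt-updates; updateAt-minimal)
  open import Data.Product using (Σ; ∃; ∃₂; _×_; proj₁; proj₂)
  open import Data.Sum using (_⊎_; inj₁; inj₂)
  open import Function using (_∘_; const; id)
  open import Relation.Nullary using (Dec; yes; no; does; _×-dec_; _⊎-dec_; contradiction)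
  open import Relation.Nullary.Decidable using (dec-true; dec-false; proof)
  open import Relation.Nullary.Reflects using (Reflects; invert)
  open import Relation.Binary.PropositionalEquality
    using (_≡_; _≢_; refl; sym; trans; cong; cong₂; subst; module ≡-Reasoning)

  total : ∀ {n} → (Fin n → ℕ) → ℕ
  total {zero}  s = 0
  total {suc n} s = s zero + total (s ∘ suc)

  lookup≤total : ∀ {n} (s : Fin n → ℕ) z → s z ≤ total s
  lookup≤total s zero    = m≤m+n _ _
  lookup≤total s (suc z) = ≤-trans (lookup≤total (s ∘ suc) z) (m≤n+m _ _)

  total-updateAt-pred : ∀ {n} (s : Fin n → ℕ) y → 0 < s y → suc (total (updateAt s y pred)) ≡ total s
  total-updateAt-pred s zero 0<sy with s zero
  ... | suc _ = refl
  total-updateAt-pred s (suc y) 0<sy =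
    trans (sym (+-suc (s zero) _)) (cong (s zero +_) (total-updateAt-pred (s ∘ suc) y 0<sy))

  updateAt-pred-≤ : ∀ {n} (s : Fin n → ℕ) y z → updateAt s y pred z ≤ s z
  updateAt-pred-≤ s y z with z ≟ y
  ... | yes refl = ≤-trans (≤-reflexive (updateAt-updates z s)) pred[n]≤n
  ... | no z≢y   = ≤-reflexive (updateAt-minimal z y s z≢y)

  nodeBudget : ℕ → ℕ → ℕ
  nodeBudget m zero    = 1
  nodeBudget m (suc d) = suc (m * nodeBudget m d)

  module Against {m′ K : ℕ} (A : OnlineAlg (suc m′) K) where

    m : ℕ
    m = suc m′

    colourAt : List (Subset K) → ℕ → Fin m
    colourAt G j = A (take j G) (nodeAt G j)

    runAlg≡colourAt : (H : Hypergraph K) (j : Fin (nodes H)) → runAlg A H j ≡ colourAt H (toℕ j)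
    runAlg≡colourAt H j = cong (A (take (toℕ j) H)) (lookup≡nodeAt H j)

    colourAt-++ˡ : (G ns : List (Subset K)) {j : ℕ} → j < length G → colourAt (G ++ ns) j ≡ colourAt G j
    colourAt-++ˡ G ns j<n = cong₂ A (take-++ˡ G ns (<⇒≤ j<n)) (nodeAt-++ˡ G ns j<n)

    colourAt-∷ʳ : (G : List (Subset K)) (w : Subset K) → colourAt (G ∷ʳ w) (length G) ≡ A G w
    colourAt-∷ʳ G w = cong₂ A (trans (take-++ˡ G [ w ] ≤-refl) (take-all (length G) G ≤-refl)) (nodeAt-∷ʳ G w)

    -- onward j is the only hyperedge of node j that may contain a later node.
    record State : Set where
      constructor state
      field
        graph  : List (Subset K)
        onward : ℕ → Fin K

    open State

    len : State → ℕ
    len = length ∘ graph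

    extend : State → Subset K → Fin K → State
    extend (state G D) w ℓ = state (G ∷ʳ w) λ j → if does (j ℕ.≟ length G) then ℓ else D j

    onward-extend-old : ∀ st w ℓ {j} → j < len st → onward (extend st w ℓ) j ≡ onward st j
    onward-extend-old st w ℓ {j} j<n =
      cong (if_then ℓ else onward st j) (dec-false (j ℕ.≟ len st) λ j≡n → <-irrefl j≡n j<n)

    onward-extend-new : ∀ st w ℓ → onward (extend st w ℓ) (len st) ≡ ℓ
    onward-extend-new st w ℓ = cong (if_then ℓ else onward st (len st)) (dec-true (len st ℕ.≟ len st) refl)

    record Valid (st : State) : Set where
      field
        starts-after  : ∀ {j k} → mem (graph st) j k ≡ true → toℕ k ≤ j
        starts-at     : ∀ k → toℕ k < len st → mem (graph st) (toℕ k) k ≡ true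
        onward-unique : ∀ {j j′ k} → j < j′ →
                        mem (graph st) j k ≡ true → mem (graph st) j′ k ≡ true → onward st j ≡ k
        size≤m        : ∀ k → size (graph st) k ≤ m

    record Chip (st : State) (ℓ : Fin K) (x : Fin m) (p : ℕ) : Set where
      field
        size≡   : size (graph st) ℓ ≡ p
        colour≡ : ∀ {j} → mem (graph st) j ℓ ≡ true → colourAt (graph st) j ≡ x
        onward≡ : ∀ {j} → mem (graph st) j ℓ ≡ true → onward st j ≡ ℓ
        started : toℕ ℓ < len st

    record Extends (b : ℕ) (st st′ : State) : Set where
      field
        suffix  : List (Subset K)
        graph≡  : graph st′ ≡ graph st ++ suffix
        onward≡ : ∀ {j} → j < len st → onward st′ j ≡ onward st j
        fresh   : ∀ {j k} → len st ≤ j → mem (graph st′) j k ≡ true → b ≤ toℕ k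

    extends-refl : ∀ b st → Extends b st st
    extends-refl b st = record
      { suffix = [] ; graph≡ = sym (++-identityʳ (graph st)) ; onward≡ = λ _ → refl
      ; fresh  = λ {j} n≤j j∈ → contradiction (mem⇒<length (graph st) j j∈) (≤⇒≯ n≤j) }

    mem-extends : ∀ {b st st′} → Extends b st st′ → ∀ {j k} → j < len st →
      mem (graph st′) j k ≡ mem (graph st) j k
    mem-extends {st = st} ext j<n rewrite Extends.graph≡ ext = mem-++ˡ (graph st) _ j<n

    len-extends : ∀ {b st st′} → Extends b st st′ → len st ≤ len st′
    len-extends {st = st} ext rewrite Extends.graph≡ ext | length-++ (graph st) {Extends.suffix ext} = m≤m+n _ _

    extends-trans : ∀ {b b′ s₁ s₂ s₃} → b ≤ b′ →
      Extends b s₁ s₂ → Extends b′ s₂ s₃ → Extends b s₁ s₃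
    extends-trans {b} {b′} {s₁} {s₂} {s₃} b≤b′ e₁₂ e₂₃ = record
      { suffix  = E₁₂.suffix ++ E₂₃.suffix
      ; graph≡  = trans E₂₃.graph≡ (trans (cong (_++ E₂₃.suffix) E₁₂.graph≡) (++-assoc (graph s₁) _ _))
      ; onward≡ = λ j<n → trans (E₂₃.onward≡ (<-≤-trans j<n (len-extends e₁₂))) (E₁₂.onward≡ j<n)
      ; fresh   = fresh }
      where
      module E₁₂ = Extends e₁₂
      module E₂₃ = Extends e₂₃
      fresh : ∀ {j k} → len s₁ ≤ j → mem (graph s₃) j k ≡ true → b ≤ toℕ k
      fresh {j} n≤j j∈ with j <? len s₂
      ... | yes j<n₂ = E₁₂.fresh n≤j (trans (sym (mem-extends e₂₃ j<n₂)) j∈)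
      ... | no  j≮n₂ = ≤-trans b≤b′ (E₂₃.fresh (≮⇒≥ j≮n₂) j∈)

    chip-frame : ∀ {st st′ ℓ x p} → Extends (len st) st st′ → Chip st ℓ x p → Chip st′ ℓ x p
    chip-frame {st} {st′} {ℓ} {p = p} ext chip = record
      { size≡   = size≡′
      ; colour≡ = λ j∈ → trans (cong (λ G → colourAt G _) graph≡)
                           (trans (colourAt-++ˡ (graph st) suffix (old j∈)) (colour≡ (old-mem j∈)))
      ; onward≡ = λ j∈ → trans (Extends.onward≡ ext (old j∈)) (onward≡ (old-mem j∈))
      ; started = <-≤-trans started (len-extends ext) }
      where
      open Chip chip
      open Extends ext using (suffix; graph≡; fresh)
      old : ∀ {j} → mem (graph st′) j ℓ ≡ true → j < len st
      old {j} j∈ with j <? len st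
      ... | yes j<n = j<n
      ... | no  j≮n = contradiction started (≤⇒≯ (fresh (≮⇒≥ j≮n) j∈))
      old-mem : ∀ {j} → mem (graph st′) j ℓ ≡ true → mem (graph st) j ℓ ≡ true
      old-mem j∈ = trans (sym (mem-extends ext (old j∈))) j∈
      not-in-suffix : ∀ {i} → mem suffix i ℓ ≢ true
      not-in-suffix {i} i∈ = <⇒≱ (old j∈) (m≤m+n (len st) i)
        where j∈ : mem (graph st′) (len st + i) ℓ ≡ true
              j∈ = trans (cong (λ G → mem G (len st + i) ℓ) graph≡)
                     (trans (cong (λ h → vlookup h ℓ) (nodeAt-++ʳ (graph st) suffix i)) i∈)
      size≡′ : size (graph st′) ℓ ≡ p
      size≡′ = begin
        size (graph st′) ℓ                 ≡⟨ cong (λ G → size G ℓ) graph≡ ⟩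
        size (graph st ++ suffix) ℓ        ≡⟨ size-++ (graph st) suffix ℓ ⟩
        size (graph st) ℓ + size suffix ℓ  ≡⟨ cong (size (graph st) ℓ +_) (size≡0 suffix ℓ not-in-suffix) ⟩
        size (graph st) ℓ + 0              ≡⟨ +-identityʳ _ ⟩
        size (graph st) ℓ                  ≡⟨ size≡ ⟩
        p                                  ∎
        where open ≡-Reasoning

    unused-beyond : ∀ {st} → Valid st → ∀ {j k} → len st ≤ toℕ k → mem (graph st) j k ≢ true
    unused-beyond {st} valid {j} n≤k j∈ =
      ≤⇒≯ n≤k (≤-<-trans (Valid.starts-after valid j∈) (mem⇒<length (graph st) j j∈))

    record Open (st : State) (k : Fin K) : Set where
      field
        started : toℕ k < len st
        onward≡ : ∀ {j} → mem (graph st) j k ≡ true → onward st j ≡ k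
        size<m   : size (graph st) k < m

    valid-extend : ∀ {st w} ℓ → Valid st →
      (∀ k → toℕ k ≡ len st → vlookup w k ≡ true) →
      (∀ {k} → vlookup w k ≡ true → toℕ k ≡ len st ⊎ Open st k) →
      Valid (extend st w ℓ)
    valid-extend {st} {w} ℓ valid fresh∈w w-joins = record
      { starts-after = starts-after′ ; starts-at = starts-at′
      ; onward-unique = onward-unique′ ; size≤m = size≤m′ }
      where
      open Valid valid
      G = graph st
      n = len st
      <suc-n : ∀ {j k} → mem (G ∷ʳ w) j k ≡ true → j < suc n
      <suc-n {j} j∈ = subst (j <_) (length-∷ʳ G w) (mem⇒<length (G ∷ʳ w) j j∈)
      starts-after′ : ∀ {j k} → mem (G ∷ʳ w) j k ≡ true → toℕ k ≤ j
      starts-after′ j∈ with mem-∷ʳ⁻ G w j∈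
      ... | inj₁ (_ , j∈G) = starts-after j∈G
      ... | inj₂ (refl , w∋k) with w-joins w∋k
      ...   | inj₁ k≡n  = ≤-reflexive k≡n
      ...   | inj₂ o = <⇒≤ (Open.started o)
      starts-at′ : ∀ k → toℕ k < length (G ∷ʳ w) → mem (G ∷ʳ w) (toℕ k) k ≡ true
      starts-at′ k k<n+1 with m≤n⇒m<n∨m≡n (≤-pred (subst (toℕ k <_) (length-∷ʳ G w) k<n+1))
      ... | inj₁ k<n = trans (mem-++ˡ G [ w ] k<n) (starts-at k k<n)
      ... | inj₂ k≡n = trans (cong (λ j → mem (G ∷ʳ w) j k) k≡n) (trans (mem-∷ʳ-new G w) (fresh∈w k k≡n))
      onward-unique′ : ∀ {j j′ k} → j < j′ → mem (G ∷ʳ w) j k ≡ true → mem (G ∷ʳ w) j′ k ≡ true →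
        onward (extend st w ℓ) j ≡ k
      onward-unique′ {j} {j′} {k} j<j′ j∈ j′∈ =
        trans (onward-extend-old st w ℓ j<n) (old-unique (mem-∷ʳ⁻ G w j′∈))
        where
        j<n = <-≤-trans j<j′ (≤-pred (<suc-n j′∈))
        j∈G = trans (sym (mem-++ˡ G [ w ] j<n)) j∈
        old-unique : (j′ < n × mem G j′ k ≡ true) ⊎ (j′ ≡ n × vlookup w k ≡ true) → onward st j ≡ k
        old-unique (inj₁ (_ , j′∈G)) = onward-unique j<j′ j∈G j′∈G
        old-unique (inj₂ (_ , w∋k)) with w-joins w∋k
        ... | inj₁ k≡n  = contradiction j∈G (unused-beyond valid (≤-reflexive (sym k≡n)))
        ... | inj₂ o = Open.onward≡ o j∈G
      size≤m′ : ∀ k → size (G ∷ʳ w) k ≤ m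
      size≤m′ k rewrite size-∷ʳ G w k with vlookup w k in w∋k
      ... | false = size≤m k
      ... | true with w-joins w∋k
      ...   | inj₂ o = Open.size<m o
      ...   | inj₁ k≡n  =
        s≤s (≤-trans (≤-reflexive (size≡0 G k (unused-beyond valid (≤-reflexive (sym k≡n))))) z≤n)

    extends-extend : ∀ {b st w} ℓ → (∀ {k} → vlookup w k ≡ true → b ≤ toℕ k) →
      Extends b st (extend st w ℓ)
    extends-extend {b} {st} {w} ℓ w≥b = record
      { suffix = [ w ] ; graph≡ = refl ; onward≡ = onward-extend-old st w ℓ ; fresh = fresh }
      where
      fresh : ∀ {j k} → len st ≤ j → mem (graph st ∷ʳ w) j k ≡ true → b ≤ toℕ k
      fresh n≤j j∈ with mem-∷ʳ⁻ (graph st) w j∈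
      ... | inj₁ (j<n , _)   = contradiction j<n (≤⇒≯ n≤j)
      ... | inj₂ (_ , w∋k) = w≥b w∋k

    chip-extend : ∀ {st w ℓ p} → size (graph st) ℓ ≡ p →
      (∀ {j} → mem (graph st) j ℓ ≡ true → colourAt (graph st) j ≡ A (graph st) w × onward st j ≡ ℓ) →
      toℕ ℓ ≤ len st → vlookup w ℓ ≡ true → Chip (extend st w ℓ) ℓ (A (graph st) w) (suc p)
    chip-extend {st} {w} {ℓ} size≡ members ℓ≤n w∋ℓ = record
      { size≡   = trans (size-∷ʳ G w ℓ)
                    (trans (cong (λ b → (if b then 1 else 0) + size G ℓ) w∋ℓ) (cong suc size≡))
      ; colour≡ = colour≡
      ; onward≡ = onward≡
      ; started = subst (toℕ ℓ <_) (sym (length-∷ʳ G w)) (s≤s ℓ≤n) }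
      where
      G = graph st
      colour≡ : ∀ {j} → mem (G ∷ʳ w) j ℓ ≡ true → colourAt (G ∷ʳ w) j ≡ A G w
      colour≡ j∈ with mem-∷ʳ⁻ G w j∈
      ... | inj₁ (j<n , j∈G) = trans (colourAt-++ˡ G [ w ] j<n) (proj₁ (members j∈G))
      ... | inj₂ (refl , _)  = colourAt-∷ʳ G w
      onward≡ : ∀ {j} → mem (G ∷ʳ w) j ℓ ≡ true → onward (extend st w ℓ) j ≡ ℓ
      onward≡ j∈ with mem-∷ʳ⁻ G w j∈
      ... | inj₁ (j<n , j∈G) = trans (onward-extend-old st w ℓ j<n) (proj₂ (members j∈G))
      ... | inj₂ (refl , _)  = onward-extend-new st w ℓ

    chip-fresh : ∀ {st w f} → Valid st → toℕ f ≡ len st → vlookup w f ≡ true →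
      Chip (extend st w f) f (A (graph st) w) 1
    chip-fresh {st} {f = f} valid f≡n w∋f =
      chip-extend (size≡0 (graph st) f unused) (λ j∈ → contradiction j∈ unused) (≤-reflexive f≡n) w∋f
      where
      unused : ∀ {j} → mem (graph st) j f ≢ true
      unused = unused-beyond valid (≤-reflexive (sym f≡n))

    chip-grow : ∀ {st w ℓ p} → Chip st ℓ (A (graph st) w) p → vlookup w ℓ ≡ true →
      Chip (extend st w ℓ) ℓ (A (graph st) w) (suc p)
    chip-grow chip w∋ℓ = chip-extend size≡ (λ j∈ → colour≡ j∈ , onward≡ j∈) (<⇒≤ started) w∋ℓ
      where open Chip chip

    Joins : (Fin m → ℕ) → (Fin m → Fin K) → Fin K → Fin K → Set
    Joins s sl f k = k ≡ f ⊎ ∃ λ z → 0 < s z × k ≡ sl z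

    joins? : ∀ s sl f k → Dec (Joins s sl f k)
    joins? s sl f k = (k ≟ f) ⊎-dec any? λ z → (0 <? s z) ×-dec (k ≟ sl z)

    joining : (Fin m → ℕ) → (Fin m → Fin K) → Fin K → Subset K
    joining s sl f = tabulate λ k → does (joins? s sl f k)

    joining⁺ : ∀ s sl f {k} → Joins s sl f k → vlookup (joining s sl f) k ≡ true
    joining⁺ s sl f {k} joins =
      trans (lookup∘tabulate (λ k → does (joins? s sl f k)) k) (dec-true (joins? s sl f k) joins)

    joining⁻ : ∀ s sl f {k} → vlookup (joining s sl f) k ≡ true → Joins s sl f k
    joining⁻ s sl f {k} w∋k =
      invert (subst (Reflects (Joins s sl f k)) (trans (sym (lookup∘tabulate (λ k → does (joins? s sl f k)) k)) w∋k)
                    (proof (joins? s sl f k)))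

    Slots : ℕ → State → (Fin m → ℕ) → (Fin m → Fin K) → Set
    Slots b st s sl = ∀ z → 0 < s z → Chip st (sl z) z (s z) × b ≤ toℕ (sl z)

    record Outcome (b : ℕ) (st : State) (s : Fin m → ℕ) : Set where
      field
        final   : State
        edge    : Fin K
        colour  : Fin m
        valid   : Valid final
        extends : Extends b st final
        chip    : Chip final edge colour (suc (s colour))
        edge≥b  : b ≤ toℕ edge

    open Outcome

    grow : ∀ {b} st s sl → Valid st → (∀ z → s z ≤ m′) → Slots b st s sl → b ≤ len st → len st < K →
      Σ (Outcome b st s) λ o → len (final o) ≡ suc (len st)
    grow {b} st s sl st-valid bounded slots b≤n n<K = by-size-of-chip (s x) refl
      where
      f = fromℕ< n<K
      f≡n : toℕ f ≡ len st
      f≡n = toℕ-fromℕ< n<K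
      w = joining s sl f
      x = A (graph st) w
      fresh∈w : ∀ k → toℕ k ≡ len st → vlookup w k ≡ true
      fresh∈w k k≡n = joining⁺ s sl f (inj₁ (toℕ-injective (trans k≡n (sym f≡n))))
      joinable : ∀ {k} → vlookup w k ≡ true → toℕ k ≡ len st ⊎ Open st k
      joinable w∋k with joining⁻ s sl f w∋k
      ... | inj₁ refl             = inj₁ f≡n
      ... | inj₂ (z , 0<sz , refl) = inj₂ record
        { started = started ; onward≡ = onward≡ ; size<m = subst (_< m) (sym size≡) (s≤s (bounded z)) }
        where open Chip (proj₁ (slots z 0<sz))
      w≥b : ∀ {k} → vlookup w k ≡ true → b ≤ toℕ k
      w≥b w∋k with joining⁻ s sl f w∋k
      ... | inj₁ refl             = subst (b ≤_) (sym f≡n) b≤n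
      ... | inj₂ (z , 0<sz , refl) = proj₂ (slots z 0<sz)
      outcome : ∀ ℓ → b ≤ toℕ ℓ → Chip (extend st w ℓ) ℓ x (suc (s x)) →
        Σ (Outcome b st s) λ o → len (final o) ≡ suc (len st)
      outcome ℓ b≤ℓ chip = record
        { final = extend st w ℓ ; edge = ℓ ; colour = x
        ; valid = valid-extend ℓ st-valid fresh∈w joinable
        ; extends = extends-extend ℓ w≥b ; chip = chip ; edge≥b = b≤ℓ }
        , length-∷ʳ (graph st) w
      by-size-of-chip : ∀ p → s x ≡ p → Σ (Outcome b st s) λ o → len (final o) ≡ suc (len st)
      by-size-of-chip zero    sx≡ = outcome f (w≥b w∋f)
        (subst (Chip (extend st w f) f x ∘ suc) (sym sx≡) (chip-fresh st-valid f≡n w∋f))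
        where w∋f = joining⁺ s sl f (inj₁ refl)
      by-size-of-chip (suc p) sx≡ = outcome (sl x) (proj₂ (slots x 0<sx))
        (chip-grow (proj₁ (slots x 0<sx)) (joining⁺ s sl f (inj₂ (x , 0<sx , refl))))
        where 0<sx = subst (0 <_) (sym sx≡) (s≤s z≤n)

    outcome-from : ∀ {b b′ st₀ st s s′} → b ≤ b′ → Extends b st₀ st → (o : Outcome b′ st s′) →
      s′ (colour o) ≡ s (colour o) → Outcome b st₀ s
    outcome-from b≤b′ ext o s′≡s = record
      { final = final o ; edge = edge o ; colour = colour o ; valid = valid o
      ; extends = extends-trans b≤b′ ext (extends o)
      ; chip    = subst (Chip (final o) (edge o) (colour o) ∘ suc) s′≡s (chip o)
      ; edge≥b  = ≤-trans b≤b′ (edge≥b o) }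

    OutcomeWithin : ℕ → State → (Fin m → ℕ) → Set
    OutcomeWithin B st s = Σ (Outcome (len st) st s) λ o → len (final o) ≤ len st + B

    Pending : State → (Fin m → ℕ) → List (Fin m) → State → (Fin m → Fin K) → Set
    Pending st₀ s ys st sl = ∀ z → 0 < s z → z ∈ ys ⊎ (Chip st (sl z) z (s z) × len st₀ ≤ toℕ (sl z))

    module Fill (s : Fin m → ℕ) (bounded : ∀ z → s z ≤ m′) (B : ℕ)
      (recurse : ∀ y → 0 < s y → ∀ st → Valid st → len st + B ≤ K → OutcomeWithin B st (updateAt s y pred))
      (st₀ : State) (bud : ℕ) (bud≤K : bud ≤ K) where

      fill : ∀ ys st sl → Valid st → Extends (len st₀) st₀ st → Pending st₀ s ys st sl →
        suc (len st + length ys * B) ≤ bud → Σ (Outcome (len st₀) st₀ s) λ o → len (final o) ≤ bud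
      fill [] st sl st-valid ext pending budget =
        outcome-from ≤-refl ext (proj₁ grown) refl , ≤-trans (≤-reflexive (proj₂ grown)) n<bud
        where
        n<bud : len st < bud
        n<bud = subst (λ n → suc n ≤ bud) (+-identityʳ (len st)) budget
        slots : Slots (len st₀) st s sl
        slots z 0<sz with pending z 0<sz
        ... | inj₁ ()
        ... | inj₂ slot = slot
        grown = grow st s sl st-valid bounded slots (len-extends ext) (<-≤-trans n<bud bud≤K)
      fill (y ∷ ys) st sl st-valid ext pending budget with s y in sy≡
      ... | zero = fill ys st sl st-valid ext pending′ (≤-trans (s≤s (+-monoʳ-≤ (len st) (m≤n+m _ B))) budget)
        where
        pending′ : Pending st₀ s ys st sl
        pending′ z 0<sz with pending z 0<sz
        ... | inj₁ (here refl) = contradiction (subst (0 <_) sy≡ 0<sz) λ ()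
        ... | inj₁ (there z∈)  = inj₁ z∈
        ... | inj₂ slot        = inj₂ slot
      ... | suc _ with recurse y (subst (0 <_) (sym sy≡) (s≤s z≤n)) st st-valid (≤-trans room bud≤K)
        where room = ≤-trans (+-monoʳ-≤ (len st) (m≤m+n B _)) (<⇒≤ budget)
      ...   | o , len≤ with colour o ≟ y
      ...     | no x≢y   = outcome-from (len-extends ext) ext o (updateAt-minimal _ _ s x≢y)
                           , ≤-trans len≤ (≤-trans (+-monoʳ-≤ (len st) (m≤m+n B _)) (<⇒≤ budget))
      ...     | yes refl = fill ys (final o) (updateAt sl y (const (edge o))) (valid o)
                             (extends-trans (len-extends ext) ext (extends o)) pending′ budget′
        where
        budget′ : suc (len (final o) + length ys * B) ≤ bud
        budget′ = ≤-trans (s≤s (≤-trans (+-monoˡ-≤ _ len≤) (≤-reflexive (+-assoc (len st) B _)))) budget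
        pending′ : Pending st₀ s ys (final o) (updateAt sl y (const (edge o)))
        pending′ z 0<sz with z ≟ y
        ... | yes refl rewrite updateAt-updates z {const (edge o)} sl =
          inj₂ (subst (Chip (final o) (edge o) z) s-pred (chip o) , ≤-trans (len-extends ext) (edge≥b o))
          where s-pred : suc (updateAt s z pred z) ≡ s z
                s-pred = trans (cong suc (updateAt-updates z s)) (trans (cong (λ n → suc (pred n)) sy≡) (sym sy≡))
        ... | no z≢y rewrite updateAt-minimal z y {const (edge o)} sl z≢y with pending z 0<sz
        ...   | inj₁ (here z≡y) = contradiction z≡y z≢y
        ...   | inj₁ (there z∈) = inj₁ z∈
        ...   | inj₂ (slot , b≤) = inj₂ (chip-frame (extends o) slot , b≤)

    room-for-node : ∀ {st} d → len st + nodeBudget m d ≤ K → len st < K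
    room-for-node {st} d fits = <-≤-trans (m<m+n (len st) (nodeBudget-pos d)) fits
      where
      nodeBudget-pos : ∀ d → 0 < nodeBudget m d
      nodeBudget-pos zero    = s≤s z≤n
      nodeBudget-pos (suc d) = s≤s z≤n

    win : ∀ d s → total s ≤ d → (∀ z → s z ≤ m′) →
      ∀ st → Valid st → len st + nodeBudget m d ≤ K → OutcomeWithin (nodeBudget m d) st s
    win zero s total≤0 bounded st st-valid fits =
      proj₁ grown , ≤-reflexive (trans (proj₂ grown) (+-comm 1 (len st)))
      where
      n<K = room-for-node {st} 0 fits
      no-slots : Slots (len st) st s (const (fromℕ< n<K))
      no-slots z 0<sz = contradiction (≤-trans (lookup≤total s z) total≤0) (<⇒≱ 0<sz)
      grown = grow st s (const (fromℕ< n<K)) st-valid bounded no-slots ≤-refl n<K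
    win (suc d) s total≤ bounded st st-valid fits =
      Fill.fill s bounded (nodeBudget m d) recurse st (len st + nodeBudget m (suc d)) fits
        (allFin m) st unread-slots st-valid (extends-refl _ st) (λ z _ → inj₁ (∈-allFin z)) fits-all
      where
      recurse : ∀ y → 0 < s y → ∀ st → Valid st → len st + nodeBudget m d ≤ K →
        OutcomeWithin (nodeBudget m d) st (updateAt s y pred)
      recurse y 0<sy = win d (updateAt s y pred)
        (≤-pred (subst (_≤ suc d) (sym (total-updateAt-pred s y 0<sy)) total≤))
        (λ z → ≤-trans (updateAt-pred-≤ s y z) (bounded z))
      -- every colour is still pending, so these slots are never read
      unread-slots : Fin m → Fin K
      unread-slots _ = fromℕ< (room-for-node {st} (suc d) fits)
      fits-all : suc (len st + length (allFin m) * nodeBudget m d) ≤ len st + nodeBudget m (suc d)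
      fits-all = ≤-reflexive (trans (cong (λ l → suc (len st + l * nodeBudget m d)) (length-tabulate {n = m} id))
                                    (sym (+-suc _ _)))

    pad : ∀ p st → Valid st → len st + p ≤ K →
      Σ State λ st′ → Valid st′ × Extends (len st) st st′ × len st′ ≡ len st + p
    pad zero    st st-valid _    = st , st-valid , extends-refl _ st , sym (+-identityʳ _)
    pad (suc p) st st-valid fits
      with grow st (const 0) (const (fromℕ< n<K)) st-valid (λ _ → z≤n) (λ _ ()) ≤-refl n<K
      where n<K = <-≤-trans (m<m+n (len st) (s≤s z≤n)) fits
    ... | o , len≡
      with pad p (final o) (valid o) (subst (λ n → n + p ≤ K) (sym len≡) (subst (_≤ K) (+-suc _ p) fits))
    ...   | st′ , valid′ , ext′ , len≡′ =
      st′ , valid′ , extends-trans (len-extends (extends o)) (extends o) ext′ ,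
      trans len≡′ (trans (cong (_+ p) len≡) (sym (+-suc _ p)))

    valid⇒singleForwardEdge : ∀ {st} → Valid st → SingleForwardEdge (graph st)
    valid⇒singleForwardEdge valid j<j₁ j<j₂ j∋k₁ j₁∋k₁ j∋k₂ j₂∋k₂ =
      trans (sym (onward-unique j<j₁ j∋k₁ j₁∋k₁)) (onward-unique j<j₂ j∋k₂ j₂∋k₂)
      where open Valid valid

    validInstance : ∀ {st} → Valid st → len st ≡ K → 0 < K →
      Hyperforest (graph st) × DistinctEdges (graph st) × IsOpt m (graph st) 1
    validInstance {st} st-valid len≡K 0<K = singleForwardEdge⇒hyperforest (graph st) single , distinct , opt
      where
      open Valid st-valid
      single = valid⇒singleForwardEdge st-valid
      started : ∀ k → toℕ k < len st
      started k = subst (toℕ k <_) (sym len≡K) (toℕ<n k)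
      distinct = firstNode⇒distinctEdges (graph st) starts-after λ k → starts-at k (started k)
      opt = singleForwardEdge⇒isOpt-1 (graph st) single size≤m (starts-at (fromℕ< 0<K) (started _))

    chip⇒≤makespan : ∀ {st ℓ x p} → Chip st ℓ x p → p ≤ makespan (graph st) (runAlg A (graph st))
    chip⇒≤makespan {st} {ℓ} {x} chip =
      subst (_≤ makespan G (runAlg A G)) (trans load≡ size≡) (load≤makespan G (runAlg A G) x ℓ)
      where
      open Chip chip
      G = graph st
      load≡ = load≡size G (runAlg A G) x ℓ λ j j∈ →
        trans (runAlg≡colourAt G j) (colour≡ (inEdge⇒mem G j∈))

    forcedChip : nodeBudget m (total (const {B = Fin m} m′)) < K →
      Σ State λ st → Valid st × len st ≡ K × ∃₂ λ ℓ x → Chip st ℓ x m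
    forcedChip budget<K = proj₁ padded , proj₁ (proj₂ padded) , len≡K , edge o , colour o ,
                          chip-frame (proj₁ (proj₂ (proj₂ padded))) (chip o)
      where
      -- no node has been placed yet, so onward is never read
      empty : State
      empty = state [] (const (fromℕ< (≤-<-trans z≤n budget<K)))
      empty-valid : Valid empty
      empty-valid = record
        { starts-after  = λ {j} j∈ → contradiction (mem⇒<length (graph empty) j j∈) λ ()
        ; starts-at     = λ _ ()
        ; onward-unique = λ {j} _ j∈ → contradiction (mem⇒<length (graph empty) j j∈) λ ()
        ; size≤m        = λ _ → z≤n }
      won = win _ (const m′) ≤-refl (λ _ → ≤-refl) empty empty-valid (<⇒≤ budget<K)
      o = proj₁ won
      final≤K : len (final o) ≤ K
      final≤K = ≤-trans (proj₂ won) (<⇒≤ budget<K)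
      padded = pad (K ∸ len (final o)) (final o) (valid o) (≤-reflexive (m+[n∸m]≡n final≤K))
      len≡K = trans (proj₂ (proj₂ (proj₂ padded))) (m+[n∸m]≡n final≤K)

    hardInstance : nodeBudget m (total (const {B = Fin m} m′)) < K →
      ∃ λ (H : Hypergraph K) → Hyperforest H × DistinctEdges H × IsOpt m H 1 × m ≤ makespan H (runAlg A H)
    hardInstance budget<K with forcedChip budget<K
    ... | st , st-valid , len≡K , _ , _ , chip with validInstance st-valid len≡K (≤-<-trans z≤n budget<K)
    ...   | hyperforest , distinct , opt = graph st , hyperforest , distinct , opt , chip⇒≤makespan chip

open import Data.Nat.Properties using (n<1+n)
open import Data.Integer using (+_; +≤+)
import Data.Integer.Properties as ℤ
open import Data.Rational using (ℚ; _<_; mkℚ; *≤*) renaming (_≤_ to _≤ℚ_; _*_ to _*ℚ_)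
import Data.Rational.Properties as ℚ
import Data.Nat.Coprimality as Coprime
open import Data.Fin using (Fin)
open import Data.Empty using (⊥)
open import Data.List using ([])
open import Data.Vec using ([])
open import Function using (const)
open import Relation.Binary.PropositionalEquality using (_≡_; refl; subst)

toℚ≡mkℚ : ∀ n → toℚ n ≡ mkℚ (+ n) 0 (Coprime.sym (Coprime.1-coprimeTo n))
toℚ≡mkℚ n = ℚ.normalize-coprime (Coprime.sym (Coprime.1-coprimeTo n))

toℚ-mono-≤ : ∀ {a b} → a ≤ b → toℚ a ≤ℚ toℚ b
toℚ-mono-≤ {a} {b} a≤b rewrite toℚ≡mkℚ a | toℚ≡mkℚ b = *≤* (ℤ.*-monoʳ-≤-nonNeg (+ 1) (+≤+ a≤b))

exceeds-ratio : ∀ {m a} (r : ℚ) → r < toℚ m → m ≤ a → ¬ (toℚ a ≤ℚ r *ℚ toℚ 1)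
exceeds-ratio {a = a} r r<m m≤a a≤r = ℚ.<-irrefl refl
  (ℚ.<-≤-trans r<m (ℚ.≤-trans (toℚ-mono-≤ m≤a) (subst (toℚ a ≤ℚ_) (ℚ.*-identityʳ r) a≤r)))

theorem2 : ∀ (m : ℕ) → ∃[ K ] ∀ (r : ℚ) → r < toℚ m →
    ∀ (A : OnlineAlg m K) → ¬ CompetitiveOnHyperforests A r
theorem2 zero       = 0 , λ _ _ A _ → no-colour (A [] [])
  where no-colour : Fin 0 → ⊥
        no-colour ()
theorem2 (suc m′) = suc bound , λ r r<m A competitive →
  let H , hyperforest , distinct , opt , m≤alg = Adversary.Against.hardInstance A (n<1+n bound)
  in exceeds-ratio r r<m m≤alg (competitive H hyperforest distinct 1 opt)
  where bound = Adversary.nodeBudget (suc m′) (Adversary.total (const {B = Fin (suc m′)} m′))
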